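{- Let $\mathcal{M}=(W,\le,N,V)$ be a coherent intuitionistic neighbourhood model, $s\in W$, and $\mathcal{M}^{ur}_s=(W^{ur}_s,\le^{ur},N^{ur},V^{ur})$ its unravelling from $s$. Then for all $\vec{w}\in W^{ur}_s$ and all $\phi\in\mathcal{L}_{\Box\Diamond}$: $\mathcal{M}^{ur}_s,\vec{w}\Vdash\phi$ if and only if $\mathcal{M},\mathrm{last}(\vec{w})\Vdash\phi$.
   Context: $\mathcal{L}_{\Box\Diamond}$: formulas $\phi ::= p_i \mid \bot \mid \phi\wedge\phi \mid \phi\vee\phi \mid \phi\to\phi \mid \Box\phi\mid\Diamond\phi$. Intuitionistic neighbourhood models: for a poset $(W,\le)$, an intuitionistic neighbourhood is a partial function $a:W\rightharpoonup\mathcal{P}(W)$ whose domain $\mathrm{dom}(a)$ is an upset. A model is $(W,\le,N,V)$ with $N$ a set of intuitionistic neighbourhoods and $V$ mapping letters to upsets; $N_w=\{a\in N\mid w\in\mathrm{dom}(a)\}$. Truth: $w\Vdash p$ iff $w\in V(p)$; $\bot$ never; $\wedge,\vee$ pointwise; $w\Vdash\phi\to\psi$ iff for all $v\ge w$, $v\Vdash\phi$ implies $v\Vdash\psi$; $w\Vdash\Box\phi$ iff there is $a\in N_w$ such that for all $w'\ge w$ and all $v\in a(w')$, $v\Vdash\phi$; $w\Vdash\Diamond\phi$ iff for all $w'\ge w$ and all $a\in N_{w'}$ there is $v\in a(w')$ with $v\Vdash\phi$. $a$ is coherent if (N1) whenever $w\le w'$, $w\in\mathrm{dom}(a)$ and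 $v\in a(w)$, there is $v'\in a(w')$ with $v\le v'$; (N2) whenever $v\in a(w)$ and $v\le v'$, there is $w'\ge w$ with $v'\in a(w')$; the model is coherent if all neighbourhoods are. Paths: a path is a sequence $(w_0,r_0,w_1,\dots,r_{n-1},w_n)$ with $w_j\in W$ and for each $i$ either $r_i={\le}$ and $w_i\le w_{i+1}$, or $r_i\in N$, $w_i\in\mathrm{dom}(r_i)$ and $w_{i+1}\in r_i(w_i)$; $\mathrm{first}$, $\mathrm{last}$ are $w_0,w_n$ and its length is $n$. It is an order path if all $r_i={\le}$, a neighbourhood path if all $r_i\in N$. If $\mathrm{last}(\vec{w})\in\mathrm{dom}(a)$ and $x\in a(\mathrm{last}(\vec{w}))$, $\vec{w}:a:x$ is $\vec{w}$ extended by $a,x$; $\vec{w}\frown\vec{v}$ is concatenation identifying $\mathrm{last}(\vec{w})=\mathrm{first}(\vec{v})$. An unravelling path is $\vec{w}=\vec{v}\frown\vec{u}$ with $\vec{v}$ an order path and $\vec{u}$ a neighbourhood path; then $\vec{w}_{ord}:=\vec{v}$, $\vec{w}_{nbd}:=\vec{u}$ (splitting after the last $\le$-step). Unravelling: $W^{ur}_s$ is the set of unravelling paths with first element $s$. For $\vec{w},\vec{v}\in W^{ur}_s$ with $\vec{w}_{nbd}=(w_0,a_0,\dots,a_{n-1},w_n)$ and $\vec{v}_{nbd}=(v_0,b_0,\dots,b_{m-1},v_m)$, $\vec{w}\le^{ur}\vec{v}$ iff $n=m$, $a_i=b_i$ for all $i$, and there are order paths $\vec{t}_0,\dots,\vec{t}_n$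 all of the same length with $\mathrm{first}(\vec{t}_j)=w_j$, $\mathrm{last}(\vec{t}_j)=v_j$ and $\vec{v}_{ord}=\vec{w}_{ord}\frown\vec{t}_0$. For $\vec{w}\in W^{ur}_s$ and $a\in N$ with $\mathrm{last}(\vec{w})\in\mathrm{dom}(a)$, $a_{\vec{w}}$ is the partial function with domain $\{\vec{v}\mid\vec{w}\le^{ur}\vec{v}\}$ and $a_{\vec{w}}(\vec{v})=\{\vec{v}:a:x\mid x\in a(\mathrm{last}(\vec{v}))\}$. $N^{ur}$ is the set of all such $a_{\vec{w}}$; $V^{ur}(p_i)=\{\vec{w}\mid\mathrm{last}(\vec{w})\in V(p_i)\}$. -}

module Defs where

open import Data.Nat using (ℕ; zero; suc; _+_)
open import Data.Product using (Σ; Σ-syntax; _×_; _,_)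
open import Data.Sum using (_⊎_)
open import Data.Empty using (⊥)
open import Relation.Binary.PropositionalEquality using (_≡_)
open import Relation.Binary.Structures using (IsPartialOrder)

data Form : Set where
  var  : ℕ → Form
  ⊥'   : Form
  _∧'_ : Form → Form → Form
  _∨'_ : Form → Form → Form
  _⇒'_ : Form → Form → Form
  □'   : Form → Form
  ◇'   : Form → Form

-- The set N of neighbourhoods is given as an index type `Nb`;
-- a neighbourhood a has domain `dom a` and, for w ∈ dom a,
-- the value a(w) = { v ∣ nb a w v }.

record PreModel : Set₁ where
  field
    W   : Set
    _≤_ : W → W → Set
    Nb  : Set
    dom : Nb → W → Set
    nb  : Nb → W → W → Set
    V   : ℕ → W → Set

Upset : {W : Set} → (W → W → Set) → (W → Set) → Set
Upset {W} _≤_ P = ∀ {x y : W} → x ≤ y → P x → P y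

record Model : Set₁ where
  field
    pre : PreModel
  open PreModel pre public
  field
    isPO      : IsPartialOrder _≡_ _≤_
    dom-upset : ∀ a → Upset _≤_ (dom a)
    nb⇒dom    : ∀ {a w v} → nb a w v → dom a w
    V-upset   : ∀ p → Upset _≤_ (V p)

record Coherent (M : Model) : Set where
  open Model M
  field
    N1 : ∀ a {w w' v} → w ≤ w' → dom a w → nb a w v →
         Σ[ v' ∈ W ] (nb a w' v' × v ≤ v')
    N2 : ∀ a {w v v'} → nb a w v → v ≤ v' →
         Σ[ w' ∈ W ] (w ≤ w' × nb a w' v')

module _ (M : PreModel) where
  open PreModel M

  _⊩_ : W → Form → Set
  w ⊩ var p    = V p w
  w ⊩ ⊥'       = ⊥
  w ⊩ (φ ∧' ψ) = (w ⊩ φ) × (w ⊩ ψ)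
  w ⊩ (φ ∨' ψ) = (w ⊩ φ) ⊎ (w ⊩ ψ)
  w ⊩ (φ ⇒' ψ) = ∀ v → w ≤ v → v ⊩ φ → v ⊩ ψ
  w ⊩ □' φ     = Σ[ a ∈ Nb ] (dom a w ×
                   (∀ w' → w ≤ w' → ∀ v → nb a w' v → v ⊩ φ))
  w ⊩ ◇' φ     = ∀ w' → w ≤ w' → ∀ a → dom a w' →
                   Σ[ v ∈ W ] (nb a w' v × v ⊩ φ)

module Unravel (M : Model) where
  open Model M

  data OPath : W → W → Set where
    ostop : ∀ {x} → OPath x x
    ostep : ∀ {x y z} → x ≤ y → OPath y z → OPath x z

  olength : ∀ {x y} → OPath x y → ℕ
  olength ostop         = 0
  olength (ostep _ p)   = suc (olength p)

  _++o_ : ∀ {x y z} → OPath x y → OPath y z → OPath x z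
  ostop       ++o q = q
  ostep r p   ++o q = ostep r (p ++o q)

  data NPath (t : W) : W → Set where
    nstop : NPath t t
    _▷⟨_,_⟩ : ∀ {y z} → NPath t y → (a : Nb) → nb a y z → NPath t z

  -- unravelling path from s: an order path s ⋯ mid, then a
  -- neighbourhood path mid ⋯ lst (split after the last ≤-step)
  record UPath (s : W) : Set where
    constructor upath
    field
      {mid lst} : W
      ord : OPath s mid
      nbd : NPath mid lst
  open UPath public

  -- pointwise comparison of the neighbourhood parts w_j, v_j (j ≥ 1):
  -- same labels, and order paths t_j : w_j ⋯ v_j of length k
  data NSim (k : ℕ) : ∀ {x x' y y'} → NPath x x' → NPath y y' → Set where
    sstop : ∀ {x y} → NSim k (nstop {x}) (nstop {y})
    sstep : ∀ {x x' y y' z z'} {p : NPath x x'} {q : NPath y y'} →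
            NSim k p q → (a : Nb) (h : nb a x' z) (h' : nb a y' z')
            (t : OPath z z') → olength t ≡ k →
            NSim k (p ▷⟨ a , h ⟩) (q ▷⟨ a , h' ⟩)

  _≤ur_ : ∀ {s} → UPath s → UPath s → Set
  u ≤ur v = Σ[ k ∈ ℕ ] Σ[ t₀ ∈ OPath (mid u) (mid v) ]
              (olength t₀ ≡ k × ord v ≡ ord u ++o t₀ × NSim k (nbd u) (nbd v))

  extend : ∀ {s} (v : UPath s) (a : Nb) {x} → nb a (lst v) x → UPath s
  extend (upath o n) a h = upath o (n ▷⟨ a , h ⟩)

  -- N^ur : the neighbourhoods a_w for w ∈ W^ur_s and last(w) ∈ dom a
  NbUr : W → Set
  NbUr s = Σ[ u ∈ UPath s ] Σ[ a ∈ Nb ] dom a (lst u)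

  unravel : W → PreModel
  unravel s = record
    { W   = UPath s
    ; _≤_ = _≤ur_
    ; Nb  = NbUr s
    ; dom = λ { (u , a , _) v → u ≤ur v }
    ; nb  = λ { (u , a , _) v v' → u ≤ur v ×
                  Σ[ x ∈ W ] Σ[ h ∈ nb a (lst v) x ] (v' ≡ extend v a h) }
    ; V   = λ p v → V p (lst v)
    }

{-# OPTIONS --safe #-}

-- The map last : W^ur_s → W is a bounded morphism. It is monotone, and it has
-- the back property: if last(w) ≤ y, pulling the step last(w) ≤ y backwards
-- along the neighbourhood part of w, one arrow at a time by (N2), yields
-- w ≤ur w' with last(w') = y. The neighbourhoods a_w of the unravelling are
-- copies of those of M, and a_w(v) is sent by last onto a(last(v)). With these
-- two facts every clause of the forcing relation transfers along last.

module Submission where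

open import Defs
open import Function.Bundles using (_⇔_; mk⇔; Equivalence)
open import Function.Properties.Equivalence using () renaming (refl to ⇔-refl)
open import Data.Nat using (suc; _+_)
open import Data.Product using (Σ-syntax; _×_; _,_)
open import Data.Product.Function.NonDependent.Propositional using (_×-⇔_)
open import Data.Sum.Function.Propositional using (_⊎-⇔_)
open import Relation.Binary.PropositionalEquality using (_≡_; refl; sym; trans; cong; cong₂)
open import Relation.Binary.Structures using (IsPartialOrder)

open Equivalence using (to; from)

module _ (M : Model) where
  open Model M
  open Unravel M
  open IsPartialOrder isPO using () renaming (refl to ≤-refl; trans to ≤-trans)

  OPath⇒≤ : ∀ {x y} → OPath x y → x ≤ y
  OPath⇒≤ ostop       = ≤-refl
  OPath⇒≤ (ostep r p) = ≤-trans r (OPath⇒≤ p)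

  ++o-identityʳ : ∀ {x y} (p : OPath x y) → p ++o ostop ≡ p
  ++o-identityʳ ostop       = refl
  ++o-identityʳ (ostep r p) = cong (ostep r) (++o-identityʳ p)

  ++o-assoc : ∀ {x y z u} (p : OPath x y) (q : OPath y z) (r : OPath z u) →
              (p ++o q) ++o r ≡ p ++o (q ++o r)
  ++o-assoc ostop       q r = refl
  ++o-assoc (ostep _ p) q r = cong (ostep _) (++o-assoc p q r)

  olength-++o : ∀ {x y z} (p : OPath x y) (q : OPath y z) →
                olength (p ++o q) ≡ olength p + olength q
  olength-++o ostop       q = refl
  olength-++o (ostep _ p) q = cong suc (olength-++o p q)

  NSim-refl : ∀ {x y} (n : NPath x y) → NSim 0 n n
  NSim-refl nstop          = sstop
  NSim-refl (n ▷⟨ a , h ⟩) = sstep (NSim-refl n) a h h ostop refl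

  NSim-trans : ∀ {k l x x' y y' z z'} {p : NPath x x'} {q : NPath y y'} {r : NPath z z'} →
               NSim k p q → NSim l q r → NSim (k + l) p r
  NSim-trans sstop sstop = sstop
  NSim-trans (sstep pq a h h' t e) (sstep qr .a .h' h'' t' e') =
    sstep (NSim-trans pq qr) a h h'' (t ++o t') (trans (olength-++o t t') (cong₂ _+_ e e'))

  NSim-lst : ∀ {k x x' y y'} {p : NPath x x'} {q : NPath y y'} →
             NSim k p q → OPath x y → OPath x' y'
  NSim-lst sstop                t = t
  NSim-lst (sstep _ _ _ _ t' _) _ = t'

  module _ {s : W} where

    ≤ur-refl : (u : UPath s) → u ≤ur u
    ≤ur-refl (upath o n) = 0 , ostop , refl , sym (++o-identityʳ o) , NSim-refl n

    ≤ur-trans : {u v w : UPath s} → u ≤ur v → v ≤ur w → u ≤ur w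
    ≤ur-trans {upath o _} (k , t , ek , eo , uv) (l , t' , el , eo' , vw) =
      k + l , t ++o t' , trans (olength-++o t t') (cong₂ _+_ ek el) ,
      trans eo' (trans (cong (_++o t') eo) (++o-assoc o t t')) , NSim-trans uv vw

    ≤ur⇒≤ : {u v : UPath s} → u ≤ur v → lst u ≤ lst v
    ≤ur⇒≤ (_ , t , _ , _ , uv) = OPath⇒≤ (NSim-lst uv t)

  -- Condition (N2) of coherence, the only part of it the truth lemma needs.
  BackCoherent : Set
  BackCoherent = ∀ a {w v v'} → nb a w v → v ≤ v' → Σ[ w' ∈ W ] (w ≤ w' × nb a w' v')

  module _ (n2 : BackCoherent) where

    NPath-lift : ∀ {m l} (n : NPath m l) {y} → l ≤ y →
                 Σ[ m' ∈ W ] (m ≤ m' × Σ[ n' ∈ NPath m' y ] NSim 1 n n')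
    NPath-lift nstop {y} r = y , r , nstop , sstop
    NPath-lift (n ▷⟨ a , h ⟩) r with n2 a h r
    ... | w' , r' , h' with NPath-lift n r'
    ...   | m' , r'' , n' , sim = m' , r'' , n' ▷⟨ a , h' ⟩ , sstep sim a h h' (ostep r ostop) refl

    ≤ur-lift : ∀ {s y} (u : UPath s) → lst u ≤ y → Σ[ u' ∈ UPath s ] (u ≤ur u' × lst u' ≡ y)
    ≤ur-lift (upath o n) r with NPath-lift n r
    ... | _ , r' , n' , sim =
      upath (o ++o ostep r' ostop) n' , (1 , ostep r' ostop , refl , refl , sim) , refl

    module _ (s : W) where

      infix 4 _⊩ᵘ_ _⊩ᴹ_

      _⊩ᵘ_ : UPath s → Form → Set
      _⊩ᵘ_ = _⊩_ (unravel s)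

      _⊩ᴹ_ : W → Form → Set
      _⊩ᴹ_ = _⊩_ pre

      Transfers : Form → Set
      Transfers φ = ∀ w → w ⊩ᵘ φ ⇔ lst w ⊩ᴹ φ

      transfers-⇒ : ∀ {φ ψ} → Transfers φ → Transfers ψ → Transfers (φ ⇒' ψ)
      transfers-⇒ {φ} {ψ} ihφ ihψ w = mk⇔ down up
        where
        down : w ⊩ᵘ φ ⇒' ψ → lst w ⊩ᴹ φ ⇒' ψ
        down f y r yφ with ≤ur-lift w r
        ... | w' , w≤w' , refl = to (ihψ w') (f w' w≤w' (from (ihφ w') yφ))

        up : lst w ⊩ᴹ φ ⇒' ψ → w ⊩ᵘ φ ⇒' ψ
        up f w' w≤w' w'φ = from (ihψ w') (f (lst w') (≤ur⇒≤ w≤w') (to (ihφ w') w'φ))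

      transfers-□ : ∀ {φ} → Transfers φ → Transfers (□' φ)
      transfers-□ {φ} ih w = mk⇔ down up
        where
        down : w ⊩ᵘ □' φ → lst w ⊩ᴹ □' φ
        down ((u , a , d) , u≤w , f) = a , dom-upset a (≤ur⇒≤ u≤w) d , forced
          where
          forced : ∀ y → lst w ≤ y → ∀ x → nb a y x → x ⊩ᴹ φ
          forced y r x h with ≤ur-lift w r
          ... | w' , w≤w' , refl =
            to (ih (extend w' a h)) (f w' w≤w' (extend w' a h) (≤ur-trans u≤w w≤w' , x , h , refl))

        up : lst w ⊩ᴹ □' φ → w ⊩ᵘ □' φ
        up (a , d , f) = (w , a , d) , ≤ur-refl w , forced
          where
          forced : ∀ w' → w ≤ur w' → ∀ v →
                   w ≤ur w' × Σ[ x ∈ W ] Σ[ h ∈ nb a (lst w') x ] (v ≡ extend w' a h) → v ⊩ᵘ φ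
          forced w' w≤w' _ (_ , x , h , refl) = from (ih (extend w' a h)) (f (lst w') (≤ur⇒≤ w≤w') x h)

      transfers-◇ : ∀ {φ} → Transfers φ → Transfers (◇' φ)
      transfers-◇ {φ} ih w = mk⇔ down up
        where
        down : w ⊩ᵘ ◇' φ → lst w ⊩ᴹ ◇' φ
        down f y r a d with ≤ur-lift w r
        ... | w' , w≤w' , refl with f w' w≤w' (w' , a , d) (≤ur-refl w')
        ...   | _ , (_ , x , h , refl) , vφ = x , h , to (ih (extend w' a h)) vφ

        up : lst w ⊩ᴹ ◇' φ → w ⊩ᵘ ◇' φ
        up f w' w≤w' (u , a , d) u≤w' with f (lst w') (≤ur⇒≤ w≤w') a (dom-upset a (≤ur⇒≤ u≤w') d)
        ... | x , h , xφ = extend w' a h , (u≤w' , x , h , refl) , from (ih (extend w' a h)) xφ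

      transfers : ∀ φ → Transfers φ
      transfers (var p)  w = ⇔-refl
      transfers ⊥'       w = ⇔-refl
      transfers (φ ∧' ψ) w = transfers φ w ×-⇔ transfers ψ w
      transfers (φ ∨' ψ) w = transfers φ w ⊎-⇔ transfers ψ w
      transfers (φ ⇒' ψ)   = transfers-⇒ {φ} {ψ} (transfers φ) (transfers ψ)
      transfers (□' φ)     = transfers-□ {φ} (transfers φ)
      transfers (◇' φ)     = transfers-◇ {φ} (transfers φ)

proposition3p33 : (M : Model) → Coherent M → (s : Model.W M) →
                  (w : Unravel.UPath M s) → (φ : Form) →
                  (_⊩_ (Unravel.unravel M s) w φ) ⇔ (_⊩_ (Model.pre M) (Unravel.UPath.lst w) φ)
proposition3p33 M C s w φ = transfers M (Coherent.N2 C) s φ w
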